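{- Let $k\geq 2$ and $n$ be positive integers and let $a_1<a_2<\cdots<a_k$ be positive integers satisfying $\frac{n}{2^{n}}=\sum_{i=1}^{k}\frac{a_{i}}{2^{a_{i}}}$. Then $$\frac{a_k^{k-1}}{2^{a_k}}\geq 2^{ -a_1}.$$
   Context: The equation $\frac{n}{2^{n}}=\sum_{i=1}^{k}\frac{a_{i}}{2^{a_{i}}}$ is considered in positive integers $n,k,a_1,\ldots,a_k$ with $k\geq 2$ and $a_1<\cdots<a_k$. -}

module Defs where

open import Data.Nat using (ℕ; zero; suc; _^_)
open import Data.Nat.Properties using (m^n≢0)
open import Data.Integer using (+_)
open import Data.Rational using (ℚ; _/_; _+_; 0ℚ)
open import Data.Fin using (Fin)
open import Data.List using (List; map; foldr)
open import Data.List using () renaming (allFin to allFinL)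

term : ℕ → ℚ
term a = _/_ (+ a) (2 ^ a) {{m^n≢0 2 a}}

ratPow2 : ℕ → ℕ → ℚ
ratPow2 m e = _/_ (+ m) (2 ^ e) {{m^n≢0 2 e}}

sumFin : (k : ℕ) → (Fin k → ℚ) → ℚ
sumFin k f = foldr _+_ 0ℚ (map f (allFinL k))

{-# OPTIONS --safe #-}
-- Multiplying by 2^N for a large N turns each a / 2^a into the integer a·2^(N−a).
-- As x / 2^x decreases on positive integers, n ≤ a₁, so 2^(N−a₁) divides the
-- left-hand side and a₁·2^(N−a₁), hence the positive tail T = Σ_{i≥2} a_i·2^(N−a_i),
-- giving 2^(N−a₁) ≤ T. For increasing x₁ < ⋯ < x_r whose scaled sum S is divisible
-- by 2^(N−x₁), the same argument bounds the head term by x₁ times the tail, so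
-- S ≤ x_r · (tail), and induction yields S ≤ x_r^r·2^(N−x_r). Applied to T this is
-- 2^(N−a₁) ≤ a_k^(k−1)·2^(N−a_k), the claim multiplied by 2^N.
module Submission where

open import Defs
open import Data.Nat using (ℕ; zero; suc; _+_; _*_; _∸_; _^_; _≤_; _<_; z≤n; s≤s; z<s; NonZero; >-nonZero; >-nonZero⁻¹)
open import Data.Nat.Properties
open import Data.Nat.Divisibility using (_∣_; divides; ∣-trans; n∣m*n; ∣m+n∣m⇒∣n; ∣⇒≤)
open import Data.Integer as ℤ using (+_; +≤+)
import Data.Integer.Properties as ℤP
open import Data.Rational as ℚ using (ℚ; toℚᵘ) renaming (_≤_ to _≤ℚ_)
import Data.Rational.Properties as ℚP
open import Data.Rational.Unnormalised as ℚᵘ using (ℚᵘ; mkℚᵘ; *≡*; *≤*; _≃_) renaming (_/_ to _/ᵘ_)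
import Data.Rational.Unnormalised.Properties as ℚᵘP
open import Data.Fin using (Fin; zero; suc; fromℕ) renaming (_<_ to _<ᶠ_)
open import Data.List using (foldr)
import Data.List.Properties as ListP
open import Function using (_∘_; it)
open import Relation.Binary.Core using (_Preserves_⟶_)
open import Relation.Binary.PropositionalEquality
import Relation.Binary.Reasoning.Setoid as ≈-Reasoning
open import Algebra.Properties.Semiring.Sum +-*-semiring using (sum)

m^[o∸n]*m^n≡m^o : ∀ m {n o} → n ≤ o → m ^ (o ∸ n) * m ^ n ≡ m ^ o
m^[o∸n]*m^n≡m^o m {n} {o} n≤o =
  trans (sym (^-distribˡ-+-* m (o ∸ n) n)) (cong (m ^_) (m∸n+n≡m n≤o))

^-monoʳ-∣ : ∀ m {n o} → n ≤ o → m ^ n ∣ m ^ o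
^-monoʳ-∣ m {n} {o} n≤o = divides (m ^ (o ∸ n)) (sym (m^[o∸n]*m^n≡m^o m n≤o))

m+n≤m*2^n : ∀ m n .{{_ : NonZero m}} → m + n ≤ m * 2 ^ n
m+n≤m*2^n m zero = ≤-reflexive (trans (+-identityʳ m) (sym (*-identityʳ m)))
m+n≤m*2^n m (suc n) = begin
  m + suc n              ≡⟨ +-suc m n ⟩
  suc (m + n)            ≤⟨ s≤s (m+n≤m*2^n m n) ⟩
  suc (m * 2 ^ n)        ≤⟨ +-monoˡ-≤ (m * 2 ^ n) 1≤m*2^n ⟩
  m * 2 ^ n + m * 2 ^ n  ≡⟨ *-distribˡ-+ m (2 ^ n) (2 ^ n) ⟨
  m * (2 ^ n + 2 ^ n)    ≡⟨ cong (λ k → m * (2 ^ n + k)) (+-identityʳ (2 ^ n)) ⟨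
  m * 2 ^ suc n          ∎
  where
  open ≤-Reasoning
  1≤m*2^n : 1 ≤ m * 2 ^ n
  1≤m*2^n = >-nonZero⁻¹ (m * 2 ^ n) {{m*n≢0 m (2 ^ n) {{it}} {{m^n≢0 2 n}}}}

≤-last : ∀ {r} (x : Fin (suc r) → ℕ) → x Preserves _<ᶠ_ ⟶ _<_ → ∀ i → x i ≤ x (fromℕ r)
≤-last {zero}  x _   zero    = ≤-refl
≤-last {suc r} x inc zero    = <⇒≤ (inc z<s)
≤-last {suc r} x inc (suc i) = ≤-last (x ∘ suc) (λ i<j → inc (s≤s i<j)) i

module _ (N : ℕ) where

  -- 2^N · (x / 2^x), for x ≤ N
  scaled : ℕ → ℕ
  scaled x = x * 2 ^ (N ∸ x)

  scaled-pos : ∀ x .{{_ : NonZero x}} → 0 < scaled x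
  scaled-pos x = >-nonZero⁻¹ (scaled x) {{m*n≢0 x (2 ^ (N ∸ x)) {{it}} {{m^n≢0 2 (N ∸ x)}}}}

  scaled-antitone : ∀ {x y} .{{_ : NonZero x}} → x ≤ y → y ≤ N → scaled y ≤ scaled x
  scaled-antitone {x} {y} x≤y y≤N = begin
    y * 2 ^ (N ∸ y)              ≡⟨ cong (_* 2 ^ (N ∸ y)) (m+[n∸m]≡n x≤y) ⟨
    (x + d) * 2 ^ (N ∸ y)        ≤⟨ *-monoˡ-≤ (2 ^ (N ∸ y)) (m+n≤m*2^n x d) ⟩
    x * 2 ^ d * 2 ^ (N ∸ y)      ≡⟨ *-assoc x (2 ^ d) (2 ^ (N ∸ y)) ⟩
    x * (2 ^ d * 2 ^ (N ∸ y))    ≡⟨ cong (x *_) (^-distribˡ-+-* 2 d (N ∸ y)) ⟨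
    x * 2 ^ (d + (N ∸ y))        ≡⟨ cong (λ e → x * 2 ^ e) d+[N∸y]≡N∸x ⟩
    x * 2 ^ (N ∸ x)              ∎
    where
    open ≤-Reasoning
    d = y ∸ x
    d+[N∸y]≡N∸x : d + (N ∸ y) ≡ N ∸ x
    d+[N∸y]≡N∸x = begin-equality
      d + (N ∸ y)      ≡⟨ +-comm d (N ∸ y) ⟩
      N ∸ y + (y ∸ x)  ≡⟨ +-∸-assoc (N ∸ y) x≤y ⟨
      N ∸ y + y ∸ x    ≡⟨ cong (_∸ x) (m∸n+n≡m y≤N) ⟩
      N ∸ x            ∎

  module _ {r} (x : Fin (suc (suc r)) → ℕ) (inc : x Preserves _<ᶠ_ ⟶ _<_) where

    sum-tail-pos : 0 < sum (scaled ∘ x ∘ suc)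
    sum-tail-pos = ≤-trans (scaled-pos (x (suc zero)) {{>-nonZero 0<x₁}}) (m≤m+n _ _)
      where
      0<x₁ : 0 < x (suc zero)
      0<x₁ = ≤-<-trans z≤n (inc {zero} {suc zero} z<s)

    module _ (P∣S : 2 ^ (N ∸ x zero) ∣ sum (scaled ∘ x)) where

      ^∣sum-tail : 2 ^ (N ∸ x zero) ∣ sum (scaled ∘ x ∘ suc)
      ^∣sum-tail = ∣m+n∣m⇒∣n P∣S (n∣m*n (x zero))

      ^≤sum-tail : 2 ^ (N ∸ x zero) ≤ sum (scaled ∘ x ∘ suc)
      ^≤sum-tail = ∣⇒≤ {{>-nonZero sum-tail-pos}} ^∣sum-tail

      ^[N∸x₁]∣sum-tail : 2 ^ (N ∸ x (suc zero)) ∣ sum (scaled ∘ x ∘ suc)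
      ^[N∸x₁]∣sum-tail = ∣-trans (^-monoʳ-∣ 2 (∸-monoʳ-≤ N (<⇒≤ (inc z<s)))) ^∣sum-tail

  sum-scaled-≤ : ∀ r (x : Fin (suc r) → ℕ) → x Preserves _<ᶠ_ ⟶ _<_ →
                 2 ^ (N ∸ x zero) ∣ sum (scaled ∘ x) →
                 sum (scaled ∘ x) ≤ x (fromℕ r) ^ suc r * 2 ^ (N ∸ x (fromℕ r))
  sum-scaled-≤ zero x _ _ = ≤-reflexive (begin
    x zero * 2 ^ (N ∸ x zero) + 0   ≡⟨ +-identityʳ _ ⟩
    x zero * 2 ^ (N ∸ x zero)       ≡⟨ cong (_* 2 ^ (N ∸ x zero)) (*-identityʳ (x zero)) ⟨
    x zero ^ 1 * 2 ^ (N ∸ x zero)   ∎)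
    where open ≡-Reasoning
  sum-scaled-≤ (suc r) x inc P∣S = begin
    x₀ * P + S′                      ≤⟨ +-monoˡ-≤ S′ (*-monoʳ-≤ x₀ (^≤sum-tail x inc P∣S)) ⟩
    x₀ * S′ + S′                     ≡⟨ +-comm (x₀ * S′) S′ ⟩
    suc x₀ * S′                      ≤⟨ *-monoˡ-≤ S′ (inc {zero} {fromℕ (suc r)} z<s) ⟩
    l * S′                           ≤⟨ *-monoʳ-≤ l IH ⟩
    l * (l ^ suc r * 2 ^ (N ∸ l))    ≡⟨ *-assoc l (l ^ suc r) (2 ^ (N ∸ l)) ⟨
    l * l ^ suc r * 2 ^ (N ∸ l)      ∎
    where
    open ≤-Reasoning
    x₀ = x zero
    l = x (fromℕ (suc r))
    P = 2 ^ (N ∸ x₀)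
    S′ = sum (scaled ∘ x ∘ suc)
    IH : S′ ≤ l ^ suc r * 2 ^ (N ∸ l)
    IH = sum-scaled-≤ r (x ∘ suc) (λ i<j → inc (s≤s i<j)) (^[N∸x₁]∣sum-tail x inc P∣S)

  ≤-least-term : ∀ {n r} (x : Fin (suc (suc r)) → ℕ) .{{_ : NonZero (x zero)}} →
                 x Preserves _<ᶠ_ ⟶ _<_ → n ≤ N →
                 scaled n ≡ sum (scaled ∘ x) → n ≤ x zero
  ≤-least-term {n} x inc n≤N E = ≮⇒≥ λ x₀<n → <-irrefl E (begin-strict
    scaled n                                  ≤⟨ scaled-antitone (<⇒≤ x₀<n) n≤N ⟩
    scaled (x zero)                           <⟨ m<m+n _ (sum-tail-pos x inc) ⟩
    scaled (x zero) + sum (scaled ∘ x ∘ suc)  ∎)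
    where open ≤-Reasoning

  lowest-power-≤ : ∀ n m (a : Fin (suc (suc m)) → ℕ) .{{_ : NonZero (a zero)}} →
                   a Preserves _<ᶠ_ ⟶ _<_ → n ≤ N →
                   scaled n ≡ sum (scaled ∘ a) →
                   2 ^ (N ∸ a zero) ≤ a (fromℕ (suc m)) ^ suc m * 2 ^ (N ∸ a (fromℕ (suc m)))
  lowest-power-≤ n m a inc n≤N E =
    ≤-trans (^≤sum-tail a inc P∣S) (sum-scaled-≤ m (a ∘ suc) (λ i<j → inc (s≤s i<j)) (^[N∸x₁]∣sum-tail a inc P∣S))
    where
    P∣S : 2 ^ (N ∸ a zero) ∣ sum (scaled ∘ a)
    P∣S = subst (2 ^ (N ∸ a zero) ∣_) E
            (∣-trans (^-monoʳ-∣ 2 (∸-monoʳ-≤ N (≤-least-term a inc n≤N E))) (n∣m*n n))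

ι : ℕ → ℚᵘ
ι n = + n /ᵘ 1

ι-homo-+ : ∀ m n → ι (m + n) ≃ ι m ℚᵘ.+ ι n
ι-homo-+ m n = *≡* (begin
  + (m + n) ℤ.* + 1                      ≡⟨ ℤP.*-identityʳ _ ⟩
  + (m + n)                              ≡⟨ ℤP.pos-+ m n ⟩
  + m ℤ.+ + n                            ≡⟨ cong₂ ℤ._+_ (ℤP.*-identityʳ (+ m)) (ℤP.*-identityʳ (+ n)) ⟨
  + m ℤ.* + 1 ℤ.+ + n ℤ.* + 1            ≡⟨ ℤP.*-identityʳ _ ⟨
  (+ m ℤ.* + 1 ℤ.+ + n ℤ.* + 1) ℤ.* + 1  ∎)
  where open ≡-Reasoning

ι-injective : ∀ {m n} → ι m ≃ ι n → m ≡ n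
ι-injective {m} {n} (*≡* eq) =
  ℤP.+-injective (trans (sym (ℤP.*-identityʳ (+ m))) (trans eq (ℤP.*-identityʳ (+ n))))

ι-mono-≤ : ∀ {m n} → m ≤ n → ι m ℚᵘ.≤ ι n
ι-mono-≤ {m} {n} m≤n =
  *≤* (subst₂ ℤ._≤_ (sym (ℤP.*-identityʳ (+ m))) (sym (ℤP.*-identityʳ (+ n))) (+≤+ m≤n))

ι-positive : ∀ n .{{_ : NonZero n}} → ℚᵘ.Positive (ι n)
ι-positive (suc n) = _

toℚᵘ-/ : ∀ i d .{{_ : NonZero d}} → toℚᵘ (i ℚ./ d) ≃ i /ᵘ d
toℚᵘ-/ i (suc d) = ℚP.toℚᵘ-fromℚᵘ (mkℚᵘ i d)

/ᵘ-*-ι : ∀ m d q .{{_ : NonZero d}} → (+ m /ᵘ d) ℚᵘ.* ι (q * d) ≃ ι (m * q)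
/ᵘ-*-ι m d@(suc _) q = *≡* (begin
  (+ m ℤ.* + (q * d)) ℤ.* + 1  ≡⟨ ℤP.*-identityʳ _ ⟩
  + m ℤ.* + (q * d)            ≡⟨ ℤP.pos-* m (q * d) ⟨
  + (m * (q * d))              ≡⟨ cong +_ (*-assoc m q d) ⟨
  + (m * q * d)                ≡⟨ ℤP.pos-* (m * q) d ⟩
  + (m * q) ℤ.* + d            ≡⟨ cong (+ (m * q) ℤ.*_) (ℤP.*-identityʳ (+ d)) ⟨
  + (m * q) ℤ.* (+ d ℤ.* + 1)  ∎)
  where open ≡-Reasoning

ratPow2-scale : ∀ N m e → e ≤ N → toℚᵘ (ratPow2 m e) ℚᵘ.* ι (2 ^ N) ≃ ι (m * 2 ^ (N ∸ e))
ratPow2-scale N m e e≤N = begin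
  toℚᵘ (ratPow2 m e) ℚᵘ.* ι (2 ^ N)            ≈⟨ ℚᵘP.*-congʳ (toℚᵘ-/ (+ m) (2 ^ e)) ⟩
  (+ m /ᵘ 2 ^ e) ℚᵘ.* ι (2 ^ N)                ≡⟨ cong (λ p → (+ m /ᵘ 2 ^ e) ℚᵘ.* ι p) (m^[o∸n]*m^n≡m^o 2 e≤N) ⟨
  (+ m /ᵘ 2 ^ e) ℚᵘ.* ι (2 ^ (N ∸ e) * 2 ^ e)  ≈⟨ /ᵘ-*-ι m (2 ^ e) (2 ^ (N ∸ e)) ⟩
  ι (m * 2 ^ (N ∸ e))                          ∎
  where
  instance _ = m^n≢0 2 e
  open ≈-Reasoning ℚᵘP.≃-setoid

sumFin-suc : ∀ k (f : Fin (suc k) → ℚ) → sumFin (suc k) f ≡ f zero ℚ.+ sumFin k (f ∘ suc)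
sumFin-suc k f = cong (λ qs → f zero ℚ.+ foldr ℚ._+_ ℚ.0ℚ qs)
  (trans (ListP.map-tabulate suc f) (sym (ListP.map-tabulate (λ i → i) (f ∘ suc))))

sumFin-scale : ∀ k (f : Fin k → ℚ) (h : Fin k → ℕ) c →
               (∀ i → toℚᵘ (f i) ℚᵘ.* c ≃ ι (h i)) →
               toℚᵘ (sumFin k f) ℚᵘ.* c ≃ ι (sum h)
sumFin-scale zero f h c _ = ℚᵘP.*-zeroˡ c
sumFin-scale (suc k) f h c scale = begin
  toℚᵘ (sumFin (suc k) f) ℚᵘ.* c             ≡⟨ cong (λ q → toℚᵘ q ℚᵘ.* c) (sumFin-suc k f) ⟩
  toℚᵘ (f zero ℚ.+ Σf′) ℚᵘ.* c               ≈⟨ ℚᵘP.*-congʳ (ℚP.toℚᵘ-homo-+ (f zero) Σf′) ⟩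
  (toℚᵘ (f zero) ℚᵘ.+ toℚᵘ Σf′) ℚᵘ.* c       ≈⟨ ℚᵘP.*-distribʳ-+ c (toℚᵘ (f zero)) (toℚᵘ Σf′) ⟩
  toℚᵘ (f zero) ℚᵘ.* c ℚᵘ.+ toℚᵘ Σf′ ℚᵘ.* c  ≈⟨ ℚᵘP.+-cong (scale zero) (sumFin-scale k (f ∘ suc) (h ∘ suc) c (scale ∘ suc)) ⟩
  ι (h zero) ℚᵘ.+ ι (sum (h ∘ suc))          ≈⟨ ι-homo-+ (h zero) (sum (h ∘ suc)) ⟨
  ι (sum h)                                  ∎
  where
  Σf′ = sumFin k (f ∘ suc)
  open ≈-Reasoning ℚᵘP.≃-setoid

corollary2p4 : (n m : ℕ) (a : Fin (suc (suc m)) → ℕ) →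
    0 < n →
    (∀ i → 0 < a i) →
    (∀ i j → i <ᶠ j → a i < a j) →
    term n ≡ sumFin (suc (suc m)) (λ i → term (a i)) →
    ratPow2 1 (a zero) ≤ℚ ratPow2 (a (fromℕ (suc m)) ^ (suc (suc m) ∸ 1)) (a (fromℕ (suc m)))
corollary2p4 n m a _ pos inc E =
  ℚP.toℚᵘ-cancel-≤ (ℚᵘP.*-cancelʳ-≤-pos c {{ι-positive (2 ^ N) {{m^n≢0 2 N}}}} (begin
    toℚᵘ (ratPow2 1 a₀) ℚᵘ.* c     ≃⟨ ratPow2-scale N 1 a₀ (a≤N zero) ⟩
    ι (1 * 2 ^ (N ∸ a₀))           ≤⟨ ι-mono-≤ (≤-trans (≤-reflexive (*-identityˡ _)) bound) ⟩
    ι (M * 2 ^ (N ∸ L))            ≃⟨ ratPow2-scale N M L (a≤N (fromℕ (suc m))) ⟨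
    toℚᵘ (ratPow2 M L) ℚᵘ.* c      ∎))
  where
  open ℚᵘP.≤-Reasoning
  a₀ = a zero
  L = a (fromℕ (suc m))
  M = L ^ suc m
  N = n + L
  c = ι (2 ^ N)
  inc′ : a Preserves _<ᶠ_ ⟶ _<_
  inc′ {i} {j} = inc i j
  a≤N : ∀ i → a i ≤ N
  a≤N i = ≤-trans (≤-last a inc′ i) (m≤n+m L n)
  cleared : scaled N n ≡ sum (scaled N ∘ a)
  cleared = ι-injective (begin-equality
    ι (scaled N n)                         ≃⟨ ratPow2-scale N n n (m≤m+n n L) ⟨
    toℚᵘ (term n) ℚᵘ.* c                   ≡⟨ cong (λ q → toℚᵘ q ℚᵘ.* c) E ⟩
    toℚᵘ (sumFin _ (term ∘ a)) ℚᵘ.* c      ≃⟨ sumFin-scale _ (term ∘ a) (scaled N ∘ a) c (λ i → ratPow2-scale N (a i) (a i) (a≤N i)) ⟩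
    ι (sum (scaled N ∘ a))                 ∎)
  bound : 2 ^ (N ∸ a₀) ≤ M * 2 ^ (N ∸ L)
  bound = lowest-power-≤ N n m a {{>-nonZero (pos zero)}} inc′ (m≤m+n n L) cleared
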